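{- Let $G$ be a biconnected, non-Hamiltonian simple graph on $n \geq 5$ vertices that has an open ear decomposition with exactly one ear. Then $G$ is isomorphic to a graph $X$ with $V(X) = [n]$ and $E(X) = \{\{i,i+1\} : 1 \leq i \leq n-1\} \cup \{\{1,w\}\} \cup \{\{n,v\}\}$ for some integers $v,w$ satisfying $2 \leq v \leq \lfloor n/2 \rfloor < w \leq n-1$ and $v + ((n+1)-w) < n$.
   Context: An open ear decomposition of a graph $G$ is a sequence of subgraphs $[P_0,P_1,\dots,P_r]$ whose edge sets partition $E(G)$, where $P_0$ is a simple cycle and each $P_i$ ($i\ge1$) is a path with two distinct endpoints, both lying in $P_0\cup\dots\cup P_{i-1}$, and whose internal vertices lie in none of $P_0,\dots,P_{i-1}$. The number $r$ is the number of ears. A graph on $n$ vertices is Hamiltonian if it contains a cycle through all $n$ vertices. -}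

module Defs where

open import Data.Nat using (ℕ; zero; suc; _≤_; _<_)
open import Data.Fin using (Fin; toℕ)
open import Data.Bool using (Bool; true; false)
open import Data.List using (List; []; _∷_; _++_; [_]; take; length)
open import Data.List.Membership.Propositional using (_∈_; _∉_)
open import Data.List.Relation.Unary.All using (All)
open import Data.List.Relation.Unary.Unique.Propositional using (Unique)
open import Data.Product using (Σ; ∃; _×_; _,_)
open import Data.Sum using (_⊎_)
open import Data.Unit using (⊤)
open import Relation.Binary.PropositionalEquality using (_≡_; _≢_)
open import Relation.Nullary using (¬_)
open import Function.Bundles using (_⇔_; _↔_; Inverse)

record SimpleGraph (n : ℕ) : Set where
  field
    adj    : Fin n → Fin n → Bool
    sym    : ∀ x y → adj x y ≡ adj y x
    irrefl : ∀ x → adj x x ≡ false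

module _ {n : ℕ} (G : SimpleGraph n) where
  open SimpleGraph G

  Adj : Fin n → Fin n → Set
  Adj x y = adj x y ≡ true

data Consec {A : Set} : List A → A → A → Set where
  here  : ∀ {x y xs} → Consec (x ∷ y ∷ xs) x y
  there : ∀ {z x y xs} → Consec xs x y → Consec (z ∷ xs) x y

WalkEdge : {A : Set} → List A → A → A → Set
WalkEdge l x y = Consec l x y ⊎ Consec l y x

-- {x,y} is an edge of the closed walk c_0 c_1 ... c_{k-1} c_0.
CycleEdge : {A : Set} → List A → A → A → Set
CycleEdge c x y = WalkEdge (c ++ take 1 c) x y

IsSimpleCycleList : {A : Set} → List A → Set
IsSimpleCycleList c = Unique c × (3 ≤ length c)

IsCycleIn : ∀ {n} → SimpleGraph n → List (Fin n) → Set
IsCycleIn G c = IsSimpleCycleList c × (∀ x y → CycleEdge c x y → Adj G x y)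

Hamiltonian : ∀ {n} → SimpleGraph n → Set
Hamiltonian {n} G = Σ (List (Fin n)) λ c → IsCycleIn G c × (∀ v → v ∈ c)

data WalkWithin {n} (G : SimpleGraph n) (P : Fin n → Set) : Fin n → Fin n → Set where
  stay : ∀ {x} → P x → WalkWithin G P x x
  step : ∀ {x y z} → P x → Adj G x y → WalkWithin G P y z → WalkWithin G P x z

Connected : ∀ {n} → SimpleGraph n → Set
Connected {n} G = ∀ (x y : Fin n) → WalkWithin G (λ _ → ⊤) x y

Biconnected : ∀ {n} → SimpleGraph n → Set
Biconnected {n} G =
  (3 ≤ n) × Connected G ×
  (∀ (z x y : Fin n) → x ≢ z → y ≢ z → WalkWithin G (λ v → v ≢ z) x y)

record OneEarDecomposition {n} (G : SimpleGraph n) : Set where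
  field
    cyc    : List (Fin n)
    s t    : Fin n
    mids   : List (Fin n)
    cycOK  : IsSimpleCycleList cyc
    pathUnique : Unique (s ∷ mids ++ [ t ])
    s∈cyc  : s ∈ cyc
    t∈cyc  : t ∈ cyc
    midsOff : All (_∉ cyc) mids
    covers : ∀ x y → Adj G x y ⇔ (CycleEdge cyc x y ⊎ WalkEdge (s ∷ mids ++ [ t ]) x y)
    disjoint : ∀ x y → ¬ (CycleEdge cyc x y × WalkEdge (s ∷ mids ++ [ t ]) x y)

-- Edge relation of the graph X on [n] = {1,...,n} (labels are 1-based):
-- E(X) = {{i,i+1} : 1 ≤ i ≤ n-1} ∪ {{1,w}} ∪ {{n,v}}.
XEdge : (n v w : ℕ) → ℕ → ℕ → Set
XEdge n v w i j =
  (j ≡ suc i ⊎ i ≡ suc j) ⊎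
  ((i ≡ 1 × j ≡ w) ⊎ (i ≡ w × j ≡ 1)) ⊎
  ((i ≡ n × j ≡ v) ⊎ (i ≡ v × j ≡ n))

label : ∀ {n} → Fin n → ℕ
label a = suc (toℕ a)

IsoToX : ∀ {n} → SimpleGraph n → ℕ → ℕ → Set
IsoToX {n} G v w =
  Σ (Fin n ↔ Fin n) λ f →
    ∀ x y → Adj G x y ⇔ XEdge n v w (label (Inverse.to f x)) (label (Inverse.to f y))

-- With a single ear, G is a theta graph: three internally disjoint s–t paths with interiors
-- P, Q, R covering every vertex (connectivity rules out isolated vertices).  If some interior
-- is empty, the other two paths form a Hamiltonian cycle.  Otherwise sort them so that
-- |P| ≤ |Q| ≤ |R|: running from the neighbour of s on P to t, back along R to s and along Q
-- to the neighbour of t gives a Hamiltonian path whose ends are joined to s and t.  This is X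
-- with v = 1 + |P| (the position of t) and w = 2 + |P| + |R| (the position of s), and the
-- inequalities on v and w are those on |P|, |Q|, |R|.
{-# OPTIONS --safe #-}

module Submission where

open import Defs
open import Data.Empty using (⊥-elim)
open import Data.Fin using (Fin; zero; suc; toℕ; fromℕ<)
open import Data.Fin.Properties using (toℕ-fromℕ<; toℕ-injective; toℕ<n; injective⇒≤)
open import Data.List using (List; []; _∷_; _++_; [_]; length; reverse; take; initLast; _∷ʳ′_)
open import Data.List.Properties
  using (++-assoc; ++-identityʳ; reverse-++; unfold-reverse; reverse-involutive; length-++; length-reverse)
open import Data.List.Membership.Propositional using (_∈_)
open import Data.List.Membership.Propositional.Properties using (∈-∃++; ∈-++⁺ˡ; ∈-++⁺ʳ; ∈-++⁻)
open import Data.List.Relation.Unary.All using (_∷_; lookup)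
import Data.List.Relation.Unary.All.Properties as All
open import Data.List.Relation.Unary.AllPairs using ([]; _∷_)
open import Data.List.Relation.Unary.Any using (here; there)
open import Data.List.Relation.Unary.Unique.Propositional using (Unique)
import Data.List.Relation.Unary.Unique.Propositional.Properties as Unique
open import Data.List.Relation.Binary.Permutation.Propositional
  using (_↭_; prep; ↭-swap; ↭-refl; ↭-sym; ↭-trans; ↭⇒↭ₛ; module PermutationReasoning)
open import Data.List.Relation.Binary.Permutation.Propositional.Properties
  using (shift; shifts; ++-comm; ++⁺ˡ; ++⁺ʳ; ↭-reverse; ∈-resp-↭)
import Data.List.Relation.Binary.Permutation.Setoid.Properties as Permutationₛ
open import Data.Nat using (ℕ; zero; suc; _+_; _*_; _∸_; _≤_; _<_; z≤n; s≤s)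
open import Data.Nat.DivMod using (_/_; m*n/n≡m; /-monoˡ-≤; m<n*o⇒m/o<n)
open import Data.Nat.Properties
  using (n≮0; suc-injective; ≤-antisym; ≤-trans; ≤-total; +-comm; +-suc; m≤m+n; m+n∸m≡n; m≤n⇒∃[o]m+o≡n)
open import Data.Nat.Tactic.RingSolver using (solve-∀)
open import Data.Product using (Σ; _×_; _,_; proj₁; proj₂)
import Data.Product as Product
open import Data.Product.Function.NonDependent.Propositional using (_×-⇔_)
open import Data.Sum using (_⊎_; inj₁; inj₂)
import Data.Sum as Sum
open import Data.Sum.Function.Propositional using (_⊎-⇔_)
open import Function.Bundles using (_⇔_; _↔_; Inverse; Equivalence; mk⇔; mk↔ₛ′)
open import Function.Construct.Composition using (_⇔-∘_)
open import Function.Base using (_∘_; id)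
open import Relation.Nullary using (¬_)
open import Relation.Binary.PropositionalEquality
  using (_≡_; _≢_; refl; sym; trans; cong; subst; setoid; module ≡-Reasoning)

open Equivalence using (to; from)

unique-resp-↭ : {A : Set} {xs ys : List A} → xs ↭ ys → Unique xs → Unique ys
unique-resp-↭ p = Permutationₛ.Unique-resp-↭ (setoid _) (↭⇒↭ₛ p)

unique-++⁻ˡ : {A : Set} (xs : List A) {ys : List A} → Unique (xs ++ ys) → Unique xs
unique-++⁻ˡ []       _             = []
unique-++⁻ˡ (x ∷ xs) (x∉ ∷ unique) = All.++⁻ˡ xs x∉ ∷ unique-++⁻ˡ xs unique

∈-take : {A : Set} {x : A} (k : ℕ) (xs : List A) → x ∈ take k xs → x ∈ xs
∈-take (suc k) (y ∷ xs) (here x≡y)  = here x≡y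
∈-take (suc k) (y ∷ xs) (there x∈) = there (∈-take k xs x∈)

PathEdge : {A : Set} → A → A → List A → A → A → Set
PathEdge s t L = WalkEdge (s ∷ L ++ [ t ])

SamePair : {A : Set} → A → A → A → A → Set
SamePair a b x y = (x ≡ a × y ≡ b) ⊎ (x ≡ b × y ≡ a)

module _ {A : Set} where

  walkEdge-cast : ∀ {l l′ : List A} {x y} → l ≡ l′ → WalkEdge l x y → WalkEdge l′ x y
  walkEdge-cast refl w = w

  consec-++⁻ : ∀ (xs : List A) y ys {a b} →
               Consec (xs ++ y ∷ ys) a b → Consec (xs ++ [ y ]) a b ⊎ Consec (y ∷ ys) a b
  consec-++⁻ []            y ys c         = inj₂ c
  consec-++⁻ (x ∷ [])      y ys here      = inj₁ here
  consec-++⁻ (x ∷ [])      y ys (there c) = inj₂ c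
  consec-++⁻ (x ∷ x′ ∷ xs) y ys here      = inj₁ here
  consec-++⁻ (x ∷ x′ ∷ xs) y ys (there c) = Sum.map₁ there (consec-++⁻ (x′ ∷ xs) y ys c)

  consec-++⁺ : ∀ (xs : List A) y ys {a b} →
               Consec (xs ++ [ y ]) a b ⊎ Consec (y ∷ ys) a b → Consec (xs ++ y ∷ ys) a b
  consec-++⁺ []            y ys (inj₁ (there ()))
  consec-++⁺ []            y ys (inj₂ c)                 = c
  consec-++⁺ (x ∷ [])      y ys (inj₁ here)              = here
  consec-++⁺ (x ∷ [])      y ys (inj₁ (there (there ())))
  consec-++⁺ (x ∷ [])      y ys (inj₂ c)                 = there c
  consec-++⁺ (x ∷ x′ ∷ xs) y ys (inj₁ here)              = here
  consec-++⁺ (x ∷ x′ ∷ xs) y ys (inj₁ (there c))         = there (consec-++⁺ (x′ ∷ xs) y ys (inj₁ c))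
  consec-++⁺ (x ∷ x′ ∷ xs) y ys (inj₂ c)                 = there (consec-++⁺ (x′ ∷ xs) y ys (inj₂ c))

  walkEdge-++⁻ : ∀ (xs : List A) y ys {a b} →
                 WalkEdge (xs ++ y ∷ ys) a b → WalkEdge (xs ++ [ y ]) a b ⊎ WalkEdge (y ∷ ys) a b
  walkEdge-++⁻ xs y ys (inj₁ c) = Sum.map inj₁ inj₁ (consec-++⁻ xs y ys c)
  walkEdge-++⁻ xs y ys (inj₂ c) = Sum.map inj₂ inj₂ (consec-++⁻ xs y ys c)

  walkEdge-++⁺ : ∀ (xs : List A) y ys {a b} →
                 WalkEdge (xs ++ [ y ]) a b ⊎ WalkEdge (y ∷ ys) a b → WalkEdge (xs ++ y ∷ ys) a b
  walkEdge-++⁺ xs y ys (inj₁ (inj₁ c)) = inj₁ (consec-++⁺ xs y ys (inj₁ c))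
  walkEdge-++⁺ xs y ys (inj₁ (inj₂ c)) = inj₂ (consec-++⁺ xs y ys (inj₁ c))
  walkEdge-++⁺ xs y ys (inj₂ (inj₁ c)) = inj₁ (consec-++⁺ xs y ys (inj₂ c))
  walkEdge-++⁺ xs y ys (inj₂ (inj₂ c)) = inj₂ (consec-++⁺ xs y ys (inj₂ c))

  consec⇒∃++ : ∀ {l : List A} {a b} → Consec l a b →
               Σ (List A) λ u → Σ (List A) λ v → l ≡ u ++ a ∷ b ∷ v
  consec⇒∃++ (here {xs = xs}) = [] , xs , refl
  consec⇒∃++ (there {z = z} c) with consec⇒∃++ c
  ... | u , v , refl = z ∷ u , v , refl

  consec-infix : ∀ (u : List A) {a b} v → Consec (u ++ a ∷ b ∷ v) a b
  consec-infix []      v = here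
  consec-infix (x ∷ u) v = there (consec-infix u v)

  reverse-++-∷-∷ : ∀ (u : List A) a b v → reverse (u ++ a ∷ b ∷ v) ≡ reverse v ++ b ∷ a ∷ reverse u
  reverse-++-∷-∷ u a b v = begin
    reverse (u ++ a ∷ b ∷ v)                ≡⟨ reverse-++ u (a ∷ b ∷ v) ⟩
    reverse (a ∷ b ∷ v) ++ reverse u        ≡⟨ cong (_++ reverse u) (unfold-reverse a (b ∷ v)) ⟩
    (reverse (b ∷ v) ++ [ a ]) ++ reverse u ≡⟨ cong (λ z → (z ++ [ a ]) ++ reverse u) (unfold-reverse b v) ⟩
    ((reverse v ++ [ b ]) ++ [ a ]) ++ reverse u ≡⟨ ++-assoc (reverse v ++ [ b ]) [ a ] (reverse u) ⟩
    (reverse v ++ [ b ]) ++ a ∷ reverse u   ≡⟨ ++-assoc (reverse v) [ b ] (a ∷ reverse u) ⟩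
    reverse v ++ b ∷ a ∷ reverse u          ∎
    where open ≡-Reasoning

  consec-reverse : ∀ {l : List A} {a b} → Consec l a b → Consec (reverse l) b a
  consec-reverse {a = a} {b} c with consec⇒∃++ c
  ... | u , v , refl =
    subst (λ l → Consec l b a) (sym (reverse-++-∷-∷ u a b v)) (consec-infix (reverse v) (reverse u))

  walkEdge-reverse : ∀ {l : List A} {a b} → WalkEdge l a b → WalkEdge (reverse l) a b
  walkEdge-reverse (inj₁ c) = inj₂ (consec-reverse c)
  walkEdge-reverse (inj₂ c) = inj₁ (consec-reverse c)

  pathEdge-reverse : ∀ {a b : A} L {x y} → PathEdge a b L x y → PathEdge b a (reverse L) x y
  pathEdge-reverse {a} {b} L w = walkEdge-cast reverse-path (walkEdge-reverse w)
    where
    open ≡-Reasoning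
    reverse-path : reverse (a ∷ L ++ [ b ]) ≡ b ∷ reverse L ++ [ a ]
    reverse-path = begin
      reverse (a ∷ L ++ [ b ])     ≡⟨ unfold-reverse a (L ++ [ b ]) ⟩
      reverse (L ++ [ b ]) ++ [ a ] ≡⟨ cong (_++ [ a ]) (reverse-++ L [ b ]) ⟩
      b ∷ reverse L ++ [ a ]       ∎

  pathEdge-reverse⁻ : ∀ {a b : A} L {x y} → PathEdge b a (reverse L) x y → PathEdge a b L x y
  pathEdge-reverse⁻ L w =
    walkEdge-cast (cong (λ L′ → _ ∷ L′ ++ [ _ ]) (reverse-involutive L)) (pathEdge-reverse (reverse L) w)

  pathEdge-++⁻ : ∀ {s t : A} L m M {x y} →
                 PathEdge s t (L ++ m ∷ M) x y → PathEdge s m L x y ⊎ PathEdge m t M x y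
  pathEdge-++⁻ {s} {t} L m M w =
    walkEdge-++⁻ (s ∷ L) m (M ++ [ t ]) (walkEdge-cast (cong (s ∷_) (++-assoc L (m ∷ M) [ t ])) w)

  pathEdge-++⁺ : ∀ {s t : A} L m M {x y} →
                 PathEdge s m L x y ⊎ PathEdge m t M x y → PathEdge s t (L ++ m ∷ M) x y
  pathEdge-++⁺ {s} {t} L m M w =
    walkEdge-cast (sym (cong (s ∷_) (++-assoc L (m ∷ M) [ t ]))) (walkEdge-++⁺ (s ∷ L) m (M ++ [ t ]) w)

  pathEdge-[]⁻ : ∀ {a b x y : A} → PathEdge a b [] x y → SamePair a b x y
  pathEdge-[]⁻ (inj₁ here)               = inj₁ (refl , refl)
  pathEdge-[]⁻ (inj₁ (there (there ())))
  pathEdge-[]⁻ (inj₂ here)               = inj₂ (refl , refl)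
  pathEdge-[]⁻ (inj₂ (there (there ())))

  pathEdge-[]⁺ : ∀ {a b x y : A} → SamePair a b x y → PathEdge a b [] x y
  pathEdge-[]⁺ (inj₁ (refl , refl)) = inj₁ here
  pathEdge-[]⁺ (inj₂ (refl , refl)) = inj₂ here

  cycleEdge-rotate⁻ : ∀ U (s : A) V {x y} → CycleEdge (U ++ s ∷ V) x y → PathEdge s s (V ++ U) x y
  cycleEdge-rotate⁻ []      s V w = walkEdge-cast (cong (λ L → s ∷ L ++ [ s ]) (sym (++-identityʳ V))) w
  cycleEdge-rotate⁻ (u ∷ U) s V w = pathEdge-++⁺ V u U (Sum.swap (pathEdge-++⁻ U s V w))

  cycleEdge-rotate⁺ : ∀ U (s : A) V {x y} → PathEdge s s (V ++ U) x y → CycleEdge (U ++ s ∷ V) x y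
  cycleEdge-rotate⁺ []      s V w = walkEdge-cast (cong (λ L → s ∷ L ++ [ s ]) (++-identityʳ V)) w
  cycleEdge-rotate⁺ (u ∷ U) s V w = pathEdge-++⁺ U s V (Sum.swap (pathEdge-++⁻ V u U w))

  consec⇒∈ : ∀ {l : List A} {a b} → Consec l a b → a ∈ l × b ∈ l
  consec⇒∈ here      = here refl , there (here refl)
  consec⇒∈ (there c) = Product.map there there (consec⇒∈ c)

  walkEdge⇒∈ : ∀ {l : List A} {a b} → WalkEdge l a b → a ∈ l
  walkEdge⇒∈ (inj₁ c) = proj₁ (consec⇒∈ c)
  walkEdge⇒∈ (inj₂ c) = proj₂ (consec⇒∈ c)

data At {A : Set} : List A → ℕ → A → Set where
  at-head : ∀ {x xs} → At (x ∷ xs) 0 x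
  at-tail : ∀ {y xs i x} → At xs i x → At (y ∷ xs) (suc i) x

module _ {A : Set} where

  At-functional : ∀ {l : List A} {i x y} → At l i x → At l i y → x ≡ y
  At-functional at-head     at-head     = refl
  At-functional (at-tail a) (at-tail b) = At-functional a b

  At⇒∈ : ∀ {l : List A} {i x} → At l i x → x ∈ l
  At⇒∈ at-head     = here refl
  At⇒∈ (at-tail a) = there (At⇒∈ a)

  At-injective : ∀ {l : List A} {i j x} → Unique l → At l i x → At l j x → i ≡ j
  At-injective _            at-head     at-head     = refl
  At-injective (x∉ ∷ _)     at-head     (at-tail b) = ⊥-elim (lookup x∉ (At⇒∈ b) refl)
  At-injective (x∉ ∷ _)     (at-tail a) at-head     = ⊥-elim (lookup x∉ (At⇒∈ a) refl)
  At-injective (_ ∷ unique) (at-tail a) (at-tail b) = cong suc (At-injective unique a b)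

  At⇒< : ∀ {l : List A} {i x} → At l i x → i < length l
  At⇒< at-head     = s≤s z≤n
  At⇒< (at-tail a) = s≤s (At⇒< a)

  <⇒At : ∀ {l : List A} {i} → i < length l → Σ A (At l i)
  <⇒At {x ∷ l} {zero}  _       = x , at-head
  <⇒At {x ∷ l} {suc i} (s≤s p) = Product.map₂ at-tail (<⇒At p)

  ∈⇒At : ∀ {l : List A} {x} → x ∈ l → Σ ℕ λ i → At l i x
  ∈⇒At (here refl) = 0 , at-head
  ∈⇒At (there x∈)  = Product.map suc at-tail (∈⇒At x∈)

  consec⇒At : ∀ {l : List A} {a b} → Consec l a b → Σ ℕ λ i → At l i a × At l (suc i) b
  consec⇒At here      = 0 , at-head , at-tail at-head
  consec⇒At (there c) = Product.map suc (Product.map at-tail at-tail) (consec⇒At c)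

  At⇒consec : ∀ {l : List A} {i a b} → At l i a → At l (suc i) b → Consec l a b
  At⇒consec at-head     (at-tail at-head) = here
  At⇒consec (at-tail a) (at-tail b)       = there (At⇒consec a b)

  At-++-∷ : ∀ (xs : List A) {y ys} → At (xs ++ y ∷ ys) (length xs) y
  At-++-∷ []       = at-head
  At-++-∷ (x ∷ xs) = at-tail (At-++-∷ xs)

  At-++⁺ˡ : ∀ {xs : List A} {i y} ys → At xs i y → At (xs ++ ys) i y
  At-++⁺ˡ ys at-head     = at-head
  At-++⁺ˡ ys (at-tail a) = at-tail (At-++⁺ˡ ys a)

  At-++⁺ʳ : ∀ (xs : List A) {ys i y} → At ys i y → At (xs ++ ys) (length xs + i) y
  At-++⁺ʳ []       a = a
  At-++⁺ʳ (x ∷ xs) a = at-tail (At-++⁺ʳ xs a)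

module Enumeration {n} {ord : List (Fin n)} (ord-unique : Unique ord) (ord-complete : ∀ x → x ∈ ord) where

  index : Fin n → ℕ
  index x = proj₁ (∈⇒At (ord-complete x))

  At-index : ∀ x → At ord (index x) x
  At-index x = proj₂ (∈⇒At (ord-complete x))

  length≡n : length ord ≡ n
  length≡n = ≤-antisym (injective⇒≤ element-injective) (injective⇒≤ index-injective)
    where
    index′ : Fin n → Fin (length ord)
    index′ x = fromℕ< (At⇒< (At-index x))

    element : Fin (length ord) → Fin n
    element i = proj₁ (<⇒At {l = ord} (toℕ<n i))

    index-injective : ∀ {x y} → index′ x ≡ index′ y → x ≡ y
    index-injective {x} {y} e = At-functional (At-index x)
      (subst (λ k → At ord k y) (trans (sym (toℕ-fromℕ< _)) (trans (cong toℕ (sym e)) (toℕ-fromℕ< _)))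
             (At-index y))

    element-injective : ∀ {i j} → element i ≡ element j → i ≡ j
    element-injective {i} {j} e = toℕ-injective (At-injective ord-unique (proj₂ (<⇒At {l = ord} (toℕ<n i)))
      (subst (At ord (toℕ j)) (sym e) (proj₂ (<⇒At {l = ord} (toℕ<n j)))))

  index<n : ∀ x → index x < n
  index<n x = subst (index x <_) length≡n (At⇒< (At-index x))

  position : Fin n ↔ Fin n
  position = mk↔ₛ′ (λ x → fromℕ< (index<n x)) element to∘element element∘to
    where
    At-element : ∀ j → Σ (Fin n) (At ord (toℕ j))
    At-element j = <⇒At {l = ord} (subst (toℕ j <_) (sym length≡n) (toℕ<n j))
    element : Fin n → Fin n
    element j = proj₁ (At-element j)
    to∘element : ∀ j → fromℕ< (index<n (element j)) ≡ j
    to∘element j =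
      toℕ-injective (trans (toℕ-fromℕ< _) (At-injective ord-unique (At-index (element j)) (proj₂ (At-element j))))
    element∘to : ∀ x → element (fromℕ< (index<n x)) ≡ x
    element∘to x =
      At-functional (proj₂ (At-element _)) (subst (λ k → At ord k x) (sym (toℕ-fromℕ< _)) (At-index x))

  label-position : ∀ x → label (Inverse.to position x) ≡ suc (index x)
  label-position x = cong suc (toℕ-fromℕ< (index<n x))

-- Numbering the vertices along the path makes its edges the {i, i+1} of X and the chords {1, w} and {n, v}.
hamiltonianPath+chords⇒isoToX :
  ∀ {n} (G : SimpleGraph n) {p q s t : Fin n} {M : List (Fin n)} {i j : ℕ} →
  Unique (p ∷ M ++ [ q ]) → (∀ x → x ∈ p ∷ M ++ [ q ]) →
  At (p ∷ M ++ [ q ]) i t → At (p ∷ M ++ [ q ]) j s →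
  (∀ x y → Adj G x y ⇔ (WalkEdge (p ∷ M ++ [ q ]) x y ⊎ SamePair p s x y ⊎ SamePair q t x y)) →
  IsoToX G (suc i) (suc j)
hamiltonianPath+chords⇒isoToX {n} G {p} {q} {s} {t} {M} {i} {j} unique complete At-t At-s adj⇔ =
  position , λ x y → edge⇔ x y ⇔-∘ adj⇔ x y
  where
  ord = p ∷ M ++ [ q ]
  open Enumeration unique complete

  lab : Fin n → ℕ
  lab x = label (Inverse.to position x)

  At⇒label⇔ : ∀ {k z m} → At ord k z → suc k ≡ m → ∀ x → (x ≡ z) ⇔ (lab x ≡ m)
  At⇒label⇔ a e x = mk⇔
    (λ { refl → trans (label-position x) (trans (cong suc (At-injective unique (At-index x) a)) e) })
    (λ e′ → At-functional (subst (λ k′ → At ord k′ x)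
                                 (suc-injective (trans (sym (label-position x)) (trans e′ (sym e))))
                                 (At-index x))
                          a)

  consec⇔ : ∀ x y → Consec ord x y ⇔ (lab y ≡ suc (lab x))
  consec⇔ x y = mk⇔
    (λ c → let k , ax , ay = consec⇒At c in begin
      lab y             ≡⟨ label-position y ⟩
      suc (index y)     ≡⟨ cong suc (At-injective unique (At-index y) ay) ⟩
      suc (suc k)       ≡⟨ cong (2 +_) (At-injective unique ax (At-index x)) ⟩
      suc (suc (index x)) ≡⟨ cong suc (sym (label-position x)) ⟩
      suc (lab x)       ∎)
    (λ e → At⇒consec (At-index x) (subst (λ k → At ord k y)
      (suc-injective (trans (sym (label-position y)) (trans e (cong suc (label-position x))))) (At-index y)))
    where open ≡-Reasoning

  q-label : suc (length (p ∷ M)) ≡ n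
  q-label = trans (cong suc (sym (trans (length-++ M) (+-comm (length M) 1)))) length≡n

  edge⇔ : ∀ x y → (WalkEdge ord x y ⊎ SamePair p s x y ⊎ SamePair q t x y) ⇔
                  XEdge n (suc i) (suc j) (lab x) (lab y)
  edge⇔ x y =
        (consec⇔ x y ⊎-⇔ consec⇔ y x)
    ⊎-⇔ (pair⇔ at-head refl At-s refl ⊎-⇔ pair⇔ At-s refl at-head refl)
    ⊎-⇔ (pair⇔ (At-++-∷ (p ∷ M)) q-label At-t refl ⊎-⇔ pair⇔ At-t refl (At-++-∷ (p ∷ M)) q-label)
    where
    pair⇔ : ∀ {k z m k′ z′ m′} → At ord k z → suc k ≡ m → At ord k′ z′ → suc k′ ≡ m′ →
            (x ≡ z × y ≡ z′) ⇔ (lab x ≡ m × lab y ≡ m′)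
    pair⇔ a e a′ e′ = At⇒label⇔ a e x ×-⇔ At⇒label⇔ a′ e′ y

-- Theta graphs

ThetaEdge : ∀ {n} → Fin n → Fin n → (P Q R : List (Fin n)) → Fin n → Fin n → Set
ThetaEdge s t P Q R x y = PathEdge s t P x y ⊎ PathEdge s t Q x y ⊎ PathEdge s t R x y

record ThetaGraph {n} (G : SimpleGraph n) (s t : Fin n) (P Q R : List (Fin n)) : Set where
  field
    vertices-unique   : Unique (s ∷ t ∷ P ++ Q ++ R)
    vertices-complete : ∀ x → x ∈ s ∷ t ∷ P ++ Q ++ R
    adj⇔              : ∀ x y → Adj G x y ⇔ ThetaEdge s t P Q R x y

record SortedThetaGraph {n} (G : SimpleGraph n) (s t : Fin n) : Set where
  field
    {P Q R} : List (Fin n)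
    theta   : ThetaGraph G s t P Q R
    P≤Q     : length P ≤ length Q
    Q≤R     : length Q ≤ length R

module _ {n} {G : SimpleGraph n} {s t : Fin n} where

  theta-permute : ∀ {P Q R P′ Q′ R′} → s ∷ t ∷ P ++ Q ++ R ↭ s ∷ t ∷ P′ ++ Q′ ++ R′ →
                  (∀ {x y} → ThetaEdge s t P Q R x y → ThetaEdge s t P′ Q′ R′ x y) →
                  (∀ {x y} → ThetaEdge s t P′ Q′ R′ x y → ThetaEdge s t P Q R x y) →
                  ThetaGraph G s t P Q R → ThetaGraph G s t P′ Q′ R′
  theta-permute vertices↭ to′ from′ θ = record
    { vertices-unique   = unique-resp-↭ vertices↭ vertices-unique
    ; vertices-complete = λ x → ∈-resp-↭ vertices↭ (vertices-complete x)
    ; adj⇔              = λ x y → mk⇔ (to′ ∘ to (adj⇔ x y)) (from (adj⇔ x y) ∘ from′)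
    }
    where open ThetaGraph θ

  theta-swap₁₂ : ∀ {P Q R} → ThetaGraph G s t P Q R → ThetaGraph G s t Q P R
  theta-swap₁₂ {P} {Q} = theta-permute (prep s (prep t (shifts P Q))) swap swap
    where
    swap : ∀ {A B C : Set} → A ⊎ B ⊎ C → B ⊎ A ⊎ C
    swap (inj₁ a)        = inj₂ (inj₁ a)
    swap (inj₂ (inj₁ b)) = inj₁ b
    swap (inj₂ (inj₂ c)) = inj₂ (inj₂ c)

  theta-swap₂₃ : ∀ {P Q R} → ThetaGraph G s t P Q R → ThetaGraph G s t P R Q
  theta-swap₂₃ {P} {Q} {R} = theta-permute (prep s (prep t (++⁺ˡ P (++-comm Q R)))) swap swap
    where
    swap : ∀ {A B C : Set} → A ⊎ B ⊎ C → A ⊎ C ⊎ B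
    swap = Sum.map₂ Sum.swap

  theta-insert : ∀ {P Q R} → ThetaGraph G s t P Q R → length P ≤ length Q → SortedThetaGraph G s t
  theta-insert {P} {Q} {R} θ P≤Q with ≤-total (length Q) (length R)
  ... | inj₁ Q≤R = record { theta = θ ; P≤Q = P≤Q ; Q≤R = Q≤R }
  ... | inj₂ R≤Q with ≤-total (length P) (length R)
  ...   | inj₁ P≤R = record { theta = theta-swap₂₃ θ ; P≤Q = P≤R ; Q≤R = R≤Q }
  ...   | inj₂ R≤P = record { theta = theta-swap₁₂ (theta-swap₂₃ θ) ; P≤Q = R≤P ; Q≤R = P≤Q }

  theta-sort : ∀ {P Q R} → ThetaGraph G s t P Q R → SortedThetaGraph G s t
  theta-sort {P} {Q} θ with ≤-total (length P) (length Q)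
  ... | inj₁ P≤Q = theta-insert θ P≤Q
  ... | inj₂ Q≤P = theta-insert (theta-swap₁₂ θ) Q≤P

  theta-size : ∀ {P Q R} → ThetaGraph G s t P Q R → 2 + (length P + (length Q + length R)) ≡ n
  theta-size {P} {Q} θ = trans (cong (2 +_) (trans (cong (length P +_) (sym (length-++ Q))) (sym (length-++ P))))
                               (Enumeration.length≡n vertices-unique vertices-complete)
    where open ThetaGraph θ

  theta-[]⇒hamiltonian : ∀ {Q R} → 3 ≤ n → ThetaGraph G s t [] Q R → Hamiltonian G
  theta-[]⇒hamiltonian {Q} {R} n≥3 θ = C , ((C-unique , C-length) , C-edges) , C-complete
    where
    open ThetaGraph θ
    C = s ∷ Q ++ t ∷ reverse R
    C↭ : s ∷ t ∷ Q ++ R ↭ C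
    C↭ = prep s (↭-trans (↭-sym (shift t Q R)) (++⁺ˡ Q (prep t (↭-sym (↭-reverse R)))))
    C-unique : Unique C
    C-unique = unique-resp-↭ C↭ vertices-unique
    C-complete : ∀ x → x ∈ C
    C-complete x = ∈-resp-↭ C↭ (vertices-complete x)
    C-length : 3 ≤ length C
    C-length = subst (3 ≤_) (sym (Enumeration.length≡n C-unique C-complete)) n≥3
    C-edges : ∀ x y → CycleEdge C x y → Adj G x y
    C-edges x y e = from (adj⇔ x y) (inj₂ (Sum.map₂ (pathEdge-reverse⁻ R) (pathEdge-++⁻ Q t (reverse R) e)))

  theta⇒isoToX : ∀ {p P Q q R} → ThetaGraph G s t (p ∷ P) (Q ++ [ q ]) R →
                 IsoToX G (suc (length (p ∷ P))) (2 + (length (p ∷ P) + length R))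
  theta⇒isoToX {p} {P} {Q} {q} {R} θ = hamiltonianPath+chords⇒isoToX G ord-unique ord-complete At-t At-s adj⇔′
    where
    open ThetaGraph θ
    ord = p ∷ (P ++ t ∷ reverse R ++ s ∷ Q) ++ [ q ]

    ord↭ : ord ↭ s ∷ t ∷ (p ∷ P) ++ (Q ++ [ q ]) ++ R
    ord↭ = begin
      p ∷ (P ++ t ∷ reverse R ++ s ∷ Q) ++ [ q ]
        ≡⟨ cong (p ∷_) (trans (++-assoc P _ [ q ])
                              (cong (λ X → P ++ t ∷ X) (++-assoc (reverse R) (s ∷ Q) [ q ]))) ⟩
      (p ∷ P) ++ t ∷ reverse R ++ s ∷ Q ++ [ q ]
        ↭⟨ shift t (p ∷ P) _ ⟩
      t ∷ (p ∷ P) ++ reverse R ++ s ∷ Q ++ [ q ]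
        ≡⟨ cong (t ∷_) (sym (++-assoc (p ∷ P) (reverse R) _)) ⟩
      t ∷ ((p ∷ P) ++ reverse R) ++ s ∷ Q ++ [ q ]
        ↭⟨ prep t (shift s ((p ∷ P) ++ reverse R) _) ⟩
      t ∷ s ∷ ((p ∷ P) ++ reverse R) ++ Q ++ [ q ]
        ↭⟨ ↭-swap t s ↭-refl ⟩
      s ∷ t ∷ ((p ∷ P) ++ reverse R) ++ Q ++ [ q ]
        ≡⟨ cong (λ X → s ∷ t ∷ X) (++-assoc (p ∷ P) (reverse R) _) ⟩
      s ∷ t ∷ (p ∷ P) ++ reverse R ++ Q ++ [ q ]
        ↭⟨ prep s (prep t (++⁺ˡ (p ∷ P) (++-comm (reverse R) _))) ⟩
      s ∷ t ∷ (p ∷ P) ++ (Q ++ [ q ]) ++ reverse R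
        ↭⟨ prep s (prep t (++⁺ˡ (p ∷ P) (++⁺ˡ (Q ++ [ q ]) (↭-reverse R)))) ⟩
      s ∷ t ∷ (p ∷ P) ++ (Q ++ [ q ]) ++ R
        ∎
      where open PermutationReasoning

    ord-unique : Unique ord
    ord-unique = unique-resp-↭ (↭-sym ord↭) vertices-unique

    ord-complete : ∀ x → x ∈ ord
    ord-complete x = ∈-resp-↭ (↭-sym ord↭) (vertices-complete x)

    At-t : At ord (length (p ∷ P)) t
    At-t = at-tail (At-++⁺ˡ [ q ] (At-++-∷ P))

    At-s : At ord (suc (length (p ∷ P) + length R)) s
    At-s = subst (λ k → At ord (suc k) s)
                 (trans (+-suc (length P) _) (cong (λ k → suc (length P + k)) (length-reverse R)))
                 (at-tail (At-++⁺ˡ [ q ] (At-++⁺ʳ P (at-tail (At-++-∷ (reverse R))))))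

    forth : ∀ {x y} → ThetaEdge s t (p ∷ P) (Q ++ [ q ]) R x y →
            WalkEdge ord x y ⊎ SamePair p s x y ⊎ SamePair q t x y
    forth (inj₁ e) with pathEdge-++⁻ [] p P e
    ... | inj₁ e′ = inj₂ (inj₁ (Sum.swap (pathEdge-[]⁻ e′)))
    ... | inj₂ e′ = inj₁ (pathEdge-++⁺ P t _ (inj₁ e′))
    forth (inj₂ (inj₁ e)) with pathEdge-++⁻ Q q [] e
    ... | inj₁ e′ = inj₁ (pathEdge-++⁺ P t _ (inj₂ (pathEdge-++⁺ (reverse R) s Q (inj₂ e′))))
    ... | inj₂ e′ = inj₂ (inj₂ (pathEdge-[]⁻ e′))
    forth (inj₂ (inj₂ e)) =
      inj₁ (pathEdge-++⁺ P t _ (inj₂ (pathEdge-++⁺ (reverse R) s Q (inj₁ (pathEdge-reverse R e)))))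

    back : ∀ {x y} → WalkEdge ord x y ⊎ SamePair p s x y ⊎ SamePair q t x y →
           ThetaEdge s t (p ∷ P) (Q ++ [ q ]) R x y
    back (inj₁ e) with pathEdge-++⁻ P t (reverse R ++ s ∷ Q) e
    ... | inj₁ e′ = inj₁ (pathEdge-++⁺ [] p P (inj₂ e′))
    ... | inj₂ e′ with pathEdge-++⁻ (reverse R) s Q e′
    ...   | inj₁ e″ = inj₂ (inj₂ (pathEdge-reverse⁻ R e″))
    ...   | inj₂ e″ = inj₂ (inj₁ (pathEdge-++⁺ Q q [] (inj₁ e″)))
    back (inj₂ (inj₁ ps)) = inj₁ (pathEdge-++⁺ [] p P (inj₁ (pathEdge-[]⁺ (Sum.swap ps))))
    back (inj₂ (inj₂ qt)) = inj₂ (inj₁ (pathEdge-++⁺ Q q [] (inj₂ (pathEdge-[]⁺ qt))))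

    adj⇔′ : ∀ x y → Adj G x y ⇔ (WalkEdge ord x y ⊎ SamePair p s x y ⊎ SamePair q t x y)
    adj⇔′ x y = mk⇔ (forth ∘ to (adj⇔ x y)) (from (adj⇔ x y) ∘ back)

-- The parameters of X

XParameters : ℕ → ℕ → ℕ → Set
XParameters n v w = (2 ≤ v) × (v ≤ n / 2) × (n / 2 < w) × (w ≤ n ∸ 1) × (v + (suc n ∸ w) < n)

xParameters : ∀ {p q r} → 1 ≤ p → p ≤ q → q ≤ r → XParameters (2 + (p + (q + r))) (suc p) (2 + (p + r))
xParameters {suc a} _ p≤q q≤r with m≤n⇒∃[o]m+o≡n p≤q | m≤n⇒∃[o]m+o≡n q≤r
... | d , refl | e , refl =
    s≤s (s≤s z≤n)
  , subst (_≤ n / 2) (m*n/n≡m (2 + a) 2) (/-monoˡ-≤ 2 (≤-by {(2 + a) * 2} (1 + a + d + d + e) (twice-v a d e)))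
  , m<n*o⇒m/o<n {m = n} {n = w} {o = 2} (≤-by (2 + a + e) (twice-w a d e))
  , ≤-by (a + d) (n-1 a d e)
  , subst (λ k → 2 + a + k < n) (sym (trans (cong (_∸ w) (suc-n a d e)) (m+n∸m≡n w (2 + a + d))))
          (≤-by (a + d + e) (v+n+1-w a d e))
  where
  n = 2 + (suc a + ((suc a + d) + ((suc a + d) + e)))
  w = 2 + (suc a + ((suc a + d) + e))

  ≤-by : ∀ {x y} k → x + k ≡ y → x ≤ y
  ≤-by {x} k refl = m≤m+n x k

  twice-v : ∀ a d e → (2 + a) * 2 + (1 + a + d + d + e) ≡ 2 + (suc a + ((suc a + d) + ((suc a + d) + e)))
  twice-v = solve-∀
  twice-w : ∀ a d e → suc (2 + (suc a + ((suc a + d) + ((suc a + d) + e)))) + (2 + a + e) ≡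
                      (2 + (suc a + ((suc a + d) + e))) * 2
  twice-w = solve-∀
  n-1 : ∀ a d e → 2 + (suc a + ((suc a + d) + e)) + (a + d) ≡ suc (suc a + ((suc a + d) + ((suc a + d) + e)))
  n-1 = solve-∀
  suc-n : ∀ a d e → suc (2 + (suc a + ((suc a + d) + ((suc a + d) + e)))) ≡
                    2 + (suc a + ((suc a + d) + e)) + (2 + a + d)
  suc-n = solve-∀
  v+n+1-w : ∀ a d e → suc (suc (suc a) + (2 + a + d)) + (a + d + e) ≡
                      2 + (suc a + ((suc a + d) + ((suc a + d) + e)))
  v+n+1-w = solve-∀

module _ {n} {G : SimpleGraph n} {s t : Fin n} (n≥3 : 3 ≤ n) (¬hamiltonian : ¬ Hamiltonian G) where

  sortedTheta⇒X : SortedThetaGraph G s t → Σ ℕ λ v → Σ ℕ λ w → XParameters n v w × IsoToX G v w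
  sortedTheta⇒X record { P = [] ; theta = θ } = ⊥-elim (¬hamiltonian (theta-[]⇒hamiltonian n≥3 θ))
  sortedTheta⇒X record { P = p ∷ P ; Q = Q ; R = R ; theta = θ ; P≤Q = P≤Q ; Q≤R = Q≤R } with initLast Q
  ... | []       = ⊥-elim (n≮0 P≤Q)
  ... | Q′ ∷ʳ′ q =
    v , w , subst (λ m → XParameters m v w) (theta-size θ) (xParameters (s≤s z≤n) P≤Q Q≤R) , theta⇒isoToX θ
    where
    v = suc (length (p ∷ P))
    w = 2 + (length (p ∷ P) + length R)

  theta⇒X : ∀ {P Q R} → ThetaGraph G s t P Q R →
            Σ ℕ λ v → Σ ℕ λ w → XParameters n v w × IsoToX G v w
  theta⇒X = sortedTheta⇒X ∘ theta-sort

-- One-ear decompositions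

∃≢ : ∀ {m} (x : Fin (2 + m)) → Σ (Fin (2 + m)) (x ≢_)
∃≢ zero    = suc zero , λ ()
∃≢ (suc _) = zero , λ ()

module _ {n} {G : SimpleGraph n} (D : OneEarDecomposition G) where
  open OneEarDecomposition D

  cycleEdge⇒∈ : ∀ {x y} → CycleEdge cyc x y → x ∈ cyc
  cycleEdge⇒∈ e = Sum.[ id , ∈-take 1 cyc ]′ (∈-++⁻ cyc (walkEdge⇒∈ e))

  earEdge⇒∈ : ∀ {x y} → PathEdge s t mids x y → x ∈ cyc ++ mids
  earEdge⇒∈ e with walkEdge⇒∈ e
  ... | here refl = ∈-++⁺ˡ s∈cyc
  ... | there x∈ with ∈-++⁻ mids x∈
  ...   | inj₁ x∈mids      = ∈-++⁺ʳ cyc x∈mids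
  ...   | inj₂ (here refl) = ∈-++⁺ˡ t∈cyc

oneEar-complete : ∀ {m} {G : SimpleGraph (2 + m)} → Connected G → (D : OneEarDecomposition G) →
                  ∀ x → x ∈ OneEarDecomposition.cyc D ++ OneEarDecomposition.mids D
oneEar-complete connected D x with ∃≢ x
... | y , x≢y with connected x y
...   | stay _ = ⊥-elim (x≢y refl)
...   | step {y = z} _ x~z _ =
  Sum.[ ∈-++⁺ˡ ∘ cycleEdge⇒∈ D , earEdge⇒∈ D ]′ (to (OneEarDecomposition.covers D x z) x~z)

oneEar⇒theta : ∀ {n} {G : SimpleGraph n} (D : OneEarDecomposition G) →
  (∀ x → x ∈ OneEarDecomposition.cyc D ++ OneEarDecomposition.mids D) →
  Σ (List (Fin n)) λ P → Σ (List (Fin n)) λ Q →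
    ThetaGraph G (OneEarDecomposition.s D) (OneEarDecomposition.t D) P Q (OneEarDecomposition.mids D)
oneEar⇒theta {n} {G} record { cyc = cyc ; s = s ; t = t ; mids = mids ; cycOK = cyc-unique , _
                            ; pathUnique = s∉ear ∷ ear-unique ; s∈cyc = s∈cyc ; t∈cyc = t∈cyc
                            ; midsOff = mids∉cyc ; covers = covers } complete
  with ∈-∃++ s∈cyc
... | U , V , refl = A , reverse B , record
  { vertices-unique   = unique-resp-↭ vertices↭ (Unique.++⁺ cyc-unique (unique-++⁻ˡ mids ear-unique) disjoint)
  ; vertices-complete = λ x → ∈-resp-↭ vertices↭ (complete x)
  ; adj⇔              = λ x y → mk⇔ (Sum.assocʳ ∘ Sum.map₁ cycle⁻ ∘ to (covers x y))
                                    (from (covers x y) ∘ Sum.map₁ cycle⁺ ∘ Sum.assocˡ)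
  }
  where
  s≢t : s ≢ t
  s≢t = lookup s∉ear (∈-++⁺ʳ mids (here refl))

  t∈VU : t ∈ V ++ U
  t∈VU with ∈-++⁻ U t∈cyc
  ... | inj₁ t∈U         = ∈-++⁺ʳ V t∈U
  ... | inj₂ (here t≡s)  = ⊥-elim (s≢t (sym t≡s))
  ... | inj₂ (there t∈V) = ∈-++⁺ˡ t∈V

  A B : List (Fin n)
  A = proj₁ (∈-∃++ t∈VU)
  B = proj₁ (proj₂ (∈-∃++ t∈VU))

  VU≡ : V ++ U ≡ A ++ t ∷ B
  VU≡ = proj₂ (proj₂ (∈-∃++ t∈VU))

  disjoint : ∀ {x} → ¬ (x ∈ U ++ s ∷ V × x ∈ mids)
  disjoint (x∈cyc , x∈mids) = lookup mids∉cyc x∈mids x∈cyc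

  vertices↭ : (U ++ s ∷ V) ++ mids ↭ s ∷ t ∷ A ++ reverse B ++ mids
  vertices↭ = begin
    (U ++ s ∷ V) ++ mids     ↭⟨ ++⁺ʳ mids (shift s U V) ⟩
    s ∷ (U ++ V) ++ mids     ↭⟨ prep s (++⁺ʳ mids (++-comm U V)) ⟩
    s ∷ (V ++ U) ++ mids     ≡⟨ cong (λ L → s ∷ L ++ mids) VU≡ ⟩
    s ∷ (A ++ t ∷ B) ++ mids ≡⟨ cong (s ∷_) (++-assoc A (t ∷ B) mids) ⟩
    s ∷ A ++ t ∷ B ++ mids   ↭⟨ prep s (shift t A (B ++ mids)) ⟩
    s ∷ t ∷ A ++ B ++ mids   ↭⟨ prep s (prep t (++⁺ˡ A (++⁺ʳ mids (↭-sym (↭-reverse B))))) ⟩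
    s ∷ t ∷ A ++ reverse B ++ mids ∎
    where open PermutationReasoning

  cycle⁻ : ∀ {x y} → CycleEdge (U ++ s ∷ V) x y → PathEdge s t A x y ⊎ PathEdge s t (reverse B) x y
  cycle⁻ = Sum.map₂ (pathEdge-reverse B) ∘ pathEdge-++⁻ A t B
         ∘ walkEdge-cast (cong (λ L → s ∷ L ++ [ s ]) VU≡) ∘ cycleEdge-rotate⁻ U s V

  cycle⁺ : ∀ {x y} → PathEdge s t A x y ⊎ PathEdge s t (reverse B) x y → CycleEdge (U ++ s ∷ V) x y
  cycle⁺ = cycleEdge-rotate⁺ U s V ∘ walkEdge-cast (cong (λ L → s ∷ L ++ [ s ]) (sym VU≡))
         ∘ pathEdge-++⁺ A t B ∘ Sum.map₂ (pathEdge-reverse⁻ B)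

proposition3p9 : (n : ℕ) → 5 ≤ n → (G : SimpleGraph n) → Biconnected G →
    ¬ Hamiltonian G → OneEarDecomposition G →
    Σ ℕ λ v → Σ ℕ λ w →
      (2 ≤ v) × (v ≤ n / 2) × (n / 2 < w) × (w ≤ n ∸ 1) ×
      (v + (suc n ∸ w) < n) × IsoToX G v w
proposition3p9 (suc (suc m)) n≥5 G (_ , connected , _) ¬hamiltonian D
  with oneEar⇒theta D (oneEar-complete connected D)
... | _ , _ , θ with theta⇒X (≤-trans (s≤s (s≤s (s≤s z≤n))) n≥5) ¬hamiltonian θ
...   | v , w , (c₁ , c₂ , c₃ , c₄ , c₅) , iso = v , w , c₁ , c₂ , c₃ , c₄ , c₅ , iso
proposition3p9 (suc zero) (s≤s ()) _ _ _ _
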